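{- Let $\pi$ be a permutation of $[n]$ and define $\rho^*:[n]\to\mathbb{N}$ by $$\rho^*(s)=1+\sum_{s'=1}^{s-1}[\pi(s'+1)<\pi(s')]\qquad(s\in[n]).$$ Then $\rho^*$ is a minimal pile assignment function for sorting $\pi$ on queues: $\rho^*$ sorts $\pi$ on queues, and it uses $\rho^*(n)=1+\mathrm{desc}(\pi)$ piles, which is the minimum number of piles used by any pile assignment function that sorts $\pi$ on queues.
   Context: A deck of cards labelled by $[n]$ is represented by a permutation $\pi$ of $[n]$ with $\pi(s)$ the position (from the top) of label $s$. The queue shuffle of $\pi$ with pile assignments $\rho:[n]\to\mathbb{N}$ (label $s$ goes to the $\rho(s)$-th pile collected) is the unique permutation $\sigma$ of $[n]$ with $\sigma(s)<\sigma(t)$ iff $(\rho(s),\pi(s))<(\rho(t),\pi(t))$ lexicographically; $\rho$ sorts $\pi$ on queues if $\sigma$ is the identity. The number of piles used by $\rho$ is the number of distinct values of $\rho$. $[P]$ is the indicator of $P$ and $\mathrm{desc}(\pi)=\sum_{s=1}^{n-1}[\pi(s+1)<\pi(s)]$. -}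

module Defs where

open import Data.Nat as ℕ using (ℕ; zero; suc; _+_; _<ᵇ_)
open import Data.Nat.Properties using (_≟_)
open import Data.Bool using (if_then_else_)
open import Data.Fin as Fin using (Fin; toℕ; fromℕ)
open import Data.Fin.Permutation using (Permutation′; _⟨$⟩ʳ_) renaming (id to idPerm)
open import Data.List using (List; []; _∷_; map; length; take; deduplicate)
open import Data.List using () renaming (allFin to allFinL)
open import Data.Product using (_×_; _,_)
open import Data.Sum using (_⊎_)
open import Relation.Binary.PropositionalEquality using (_≡_)
open import Function.Bundles using (_⇔_)

-- Cards/labels [n] are modelled by Fin n (0-indexed; only the order matters).
-- π ⟨$⟩ʳ s is the position of label s.

LexLess : ∀ {n} → ℕ × Fin n → ℕ × Fin n → Set
LexLess (a , i) (b , j) = (a ℕ.< b) ⊎ ((a ≡ b) × (i Fin.< j))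


IsQueueShuffle : ∀ {n} → Permutation′ n → (Fin n → ℕ) → Permutation′ n → Set
IsQueueShuffle π ρ σ =
  ∀ s t → (σ ⟨$⟩ʳ s Fin.< σ ⟨$⟩ʳ t) ⇔ LexLess (ρ s , π ⟨$⟩ʳ s) (ρ t , π ⟨$⟩ʳ t)

-- ρ sorts π on queues: the queue shuffle is the identity permutation,
-- i.e. the identity satisfies the (uniquely determining) defining property.
Sorts : ∀ {n} → Permutation′ n → (Fin n → ℕ) → Set
Sorts π ρ = IsQueueShuffle π ρ idPerm

numPiles : ∀ {n} → (Fin n → ℕ) → ℕ
numPiles {n} ρ = length (deduplicate _≟_ (map ρ (allFinL n)))

descList : List ℕ → ℕ
descList [] = 0
descList (x ∷ []) = 0
descList (x ∷ y ∷ xs) = (if y <ᵇ x then 1 else 0) + descList (y ∷ xs)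

posSeq : ∀ {n} → Permutation′ n → List ℕ
posSeq {n} π = map (λ s → toℕ (π ⟨$⟩ʳ s)) (allFinL n)

desc : ∀ {n} → Permutation′ n → ℕ
desc π = descList (posSeq π)

-- ρ*(s) = 1 + Σ_{s'=1}^{s-1} [π(s'+1) < π(s')]
-- (for 0-indexed s this is 1 + descents within the first toℕ s + 1 entries)
ρ* : ∀ {n} → Permutation′ n → Fin n → ℕ
ρ* π s = 1 + descList (take (suc (toℕ s)) (posSeq π))

{-# OPTIONS --safe #-}

-- Sorting on queues only constrains adjacent labels: since the lexicographic order is
-- transitive, ρ sorts π iff for every s either ρ(s) < ρ(s+1), or ρ(s) = ρ(s+1) and
-- π(s) < π(s+1). A sorting ρ is therefore weakly increasing, so it uses 1 + (number of
-- strict ascents of ρ) piles, and each descent of π forces a strict ascent of ρ. The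
-- assignment ρ* climbs by one exactly at the descents of π and is constant elsewhere,
-- so it sorts π and meets this bound with equality.

module Submission where

open import Defs
open import Data.Nat using (ℕ; suc; _+_; _≤_)
open import Data.Fin using (Fin; fromℕ)
open import Data.Fin.Permutation using (Permutation′)
open import Data.Product using (_×_)
open import Relation.Binary.PropositionalEquality using (_≡_)

open import Data.Nat as ℕ using (zero; _<_; _<ᵇ_; z≤n; s≤s)
open import Data.Nat.Properties as ℕ
  using (_≟_; <ᵇ-reflects-<; ≤-refl; ≤-reflexive; ≤-trans; <⇒≤; <-asym; +-identityʳ; +-assoc; +-mono-≤; m<m+n; ≮⇒≥; ≤∧≢⇒<)
open import Data.Fin as Fin using (toℕ; inject₁)
import Data.Fin.Properties as Fin
open import Data.Fin.Permutation using (_⟨$⟩ʳ_; _⟨$⟩ˡ_; inverseˡ)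
open import Data.Bool using (true; false; if_then_else_)
open import Data.List using (List; []; _∷_; length; take; deduplicate; tabulate; filter)
open import Data.List.Properties using (map-tabulate; take-all; length-tabulate; filter-all; filter-idem; filter-reject)
import Data.List.Relation.Unary.All as All
open import Data.List.Relation.Unary.All.Properties using (deduplicate⁺)
open import Data.List.Relation.Unary.Linked using (Linked; []; [-]; _∷_)
open import Data.List.Relation.Unary.Linked.Properties using (Linked⇒All)
open import Data.Product using (_,_)
open import Data.Product.Relation.Binary.Pointwise.NonDependent using (Pointwise)
open import Data.Product.Relation.Binary.Lex.Strict using (×-isStrictPartialOrder)
open import Data.Sum using (inj₁; inj₂)
open import Data.Empty using (⊥-elim)
open import Relation.Nullary using (¬_; ¬?; yes; no; ofʸ; ofⁿ)
open import Relation.Binary using (Rel; Transitive; Asymmetric; IsStrictPartialOrder; tri<; tri≈; tri>)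
open import Relation.Binary.PropositionalEquality using (_≢_; refl; sym; trans; cong; cong₂; subst₂; module ≡-Reasoning)
open import Function.Bundles using (_⇔_; mk⇔; Equivalence)
open import Function using (_∘_; id)

-- Chosen so that descList (x ∷ y ∷ xs) unfolds to ⟦ y < x ⟧ + descList (y ∷ xs).
⟦_<_⟧ : ℕ → ℕ → ℕ
⟦ x < y ⟧ = if x <ᵇ y then 1 else 0

⟦<⟧-true : ∀ {x y} → x < y → ⟦ x < y ⟧ ≡ 1
⟦<⟧-true {x} {y} x<y with x <ᵇ y | <ᵇ-reflects-< x y
... | true  | _        = refl
... | false | ofⁿ x≮y = ⊥-elim (x≮y x<y)

⟦<⟧-false : ∀ {x y} → ¬ x < y → ⟦ x < y ⟧ ≡ 0
⟦<⟧-false {x} {y} x≮y with x <ᵇ y | <ᵇ-reflects-< x y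
... | true  | ofʸ x<y = ⊥-elim (x≮y x<y)
... | false | _        = refl

⟦<⟧-mono : ∀ {a b c d} → (a < b → c < d) → ⟦ a < b ⟧ ≤ ⟦ c < d ⟧
⟦<⟧-mono {a} {b} a<b⇒c<d with a <ᵇ b | <ᵇ-reflects-< a b
... | true  | ofʸ a<b = ≤-reflexive (sym (⟦<⟧-true (a<b⇒c<d a<b)))
... | false | _        = z≤n

⟦<⟧-+-self : ∀ x a b → ⟦ x < x + ⟦ a < b ⟧ ⟧ ≡ ⟦ a < b ⟧
⟦<⟧-+-self x a b with a <ᵇ b
... | true  = ⟦<⟧-true (m<m+n x (s≤s z≤n))
... | false = ⟦<⟧-false (ℕ.<-irrefl (sym (+-identityʳ x)))

ascents : List ℕ → ℕ
ascents []           = 0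
ascents (x ∷ [])     = 0
ascents (x ∷ y ∷ xs) = ⟦ x < y ⟧ + ascents (y ∷ xs)

length-deduplicate-≤-linked : ∀ {x xs} → Linked _≤_ (x ∷ xs) →
  length (deduplicate _≟_ (x ∷ xs)) ≡ 1 + ascents (x ∷ xs)
length-deduplicate-≤-linked [-] = refl
length-deduplicate-≤-linked {x} {y ∷ ys} (x≤y ∷ linked) with ℕ.m≤n⇒m<n∨m≡n x≤y
... | inj₂ refl = begin
    length (deduplicate _≟_ (x ∷ x ∷ ys))
  ≡⟨ cong (suc ∘ length) (filter-reject (¬? ∘ (x ≟_)) (λ x≢x → x≢x refl)) ⟩
    1 + length (filter≢x (filter≢x (deduplicate _≟_ ys)))
  ≡⟨ cong (suc ∘ length) (filter-idem (¬? ∘ (x ≟_)) (deduplicate _≟_ ys)) ⟩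
    length (deduplicate _≟_ (x ∷ ys))
  ≡⟨ length-deduplicate-≤-linked linked ⟩
    1 + ascents (x ∷ ys)
  ≡⟨ cong (λ k → 1 + (k + ascents (x ∷ ys))) (sym (⟦<⟧-false (ℕ.n≮n x))) ⟩
    1 + ascents (x ∷ x ∷ ys)
  ∎
  where
  open ≡-Reasoning
  filter≢x : List ℕ → List ℕ
  filter≢x = filter (¬? ∘ (x ≟_))
... | inj₁ x<y = begin
    length (deduplicate _≟_ (x ∷ y ∷ ys))
  ≡⟨ cong (suc ∘ length) (filter-all (¬? ∘ (x ≟_)) (deduplicate⁺ _≟_ (All.map (ℕ.<⇒≢ ∘ ℕ.<-≤-trans x<y) y≤ys))) ⟩
    1 + length (deduplicate _≟_ (y ∷ ys))
  ≡⟨ cong suc (length-deduplicate-≤-linked linked) ⟩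
    1 + (1 + ascents (y ∷ ys))
  ≡⟨ cong (λ k → 1 + (k + ascents (y ∷ ys))) (sym (⟦<⟧-true x<y)) ⟩
    1 + ascents (x ∷ y ∷ ys)
  ∎
  where
  open ≡-Reasoning
  y≤ys : All.All (y ≤_) (y ∷ ys)
  y≤ys = Linked⇒All ≤-trans ≤-refl linked

AdjacentPairs : ∀ {a ℓ} {A : Set a} {m} → Rel A ℓ → (Fin (suc m) → A) → Set ℓ
AdjacentPairs R f = ∀ i → R (f (inject₁ i)) (f (Fin.suc i))

module _ {a ℓ} {A : Set a} {R : Rel A ℓ} where

  Linked-tabulate⁺ : ∀ {m} {f : Fin (suc m) → A} → AdjacentPairs R f → Linked R (tabulate f)
  Linked-tabulate⁺ {zero}  adjacent = [-]
  Linked-tabulate⁺ {suc m} {f} adjacent = adjacent Fin.zero ∷ Linked-tabulate⁺ {f = f ∘ Fin.suc} (adjacent ∘ Fin.suc)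

  adjacent⇒increasing : Transitive R → ∀ {m} {f : Fin (suc m) → A} → AdjacentPairs R f →
    ∀ {s t} → s Fin.< t → R (f s) (f t)
  adjacent⇒increasing R-trans {suc m} adjacent {Fin.zero} {Fin.suc Fin.zero} _ = adjacent Fin.zero
  adjacent⇒increasing R-trans {suc m} {f} adjacent {Fin.zero} {Fin.suc (Fin.suc t)} _ =
    R-trans (adjacent Fin.zero)
            (adjacent⇒increasing R-trans {f = f ∘ Fin.suc} (adjacent ∘ Fin.suc) {Fin.zero} {Fin.suc t} (s≤s z≤n))
  adjacent⇒increasing R-trans {suc m} {f} adjacent {Fin.suc s} {Fin.suc t} (s≤s s<t) =
    adjacent⇒increasing R-trans {f = f ∘ Fin.suc} (adjacent ∘ Fin.suc) s<t

descList-tabulate≤ascents-tabulate : ∀ {m} (g f : Fin (suc m) → ℕ) →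
  (∀ i → g (Fin.suc i) < g (inject₁ i) → f (inject₁ i) < f (Fin.suc i)) →
  descList (tabulate g) ≤ ascents (tabulate f)
descList-tabulate≤ascents-tabulate {zero}  g f descent⇒ascent = z≤n
descList-tabulate≤ascents-tabulate {suc m} g f descent⇒ascent =
  +-mono-≤ (⟦<⟧-mono (descent⇒ascent Fin.zero))
           (descList-tabulate≤ascents-tabulate (g ∘ Fin.suc) (f ∘ Fin.suc) (descent⇒ascent ∘ Fin.suc))

ascents-tabulate≡descList-tabulate : ∀ {m} (g f : Fin (suc m) → ℕ) →
  (∀ i → f (Fin.suc i) ≡ f (inject₁ i) + ⟦ g (Fin.suc i) < g (inject₁ i) ⟧) →
  ascents (tabulate f) ≡ descList (tabulate g)
ascents-tabulate≡descList-tabulate {zero}  g f step = refl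
ascents-tabulate≡descList-tabulate {suc m} g f step = begin
    ⟦ f Fin.zero < f (Fin.suc Fin.zero) ⟧ + ascents (tabulate (f ∘ Fin.suc))
  ≡⟨ cong (λ k → ⟦ f Fin.zero < k ⟧ + ascents (tabulate (f ∘ Fin.suc))) (step Fin.zero) ⟩
    ⟦ f Fin.zero < f Fin.zero + ⟦ g (Fin.suc Fin.zero) < g Fin.zero ⟧ ⟧ + ascents (tabulate (f ∘ Fin.suc))
  ≡⟨ cong₂ _+_ (⟦<⟧-+-self (f Fin.zero) (g (Fin.suc Fin.zero)) (g Fin.zero))
               (ascents-tabulate≡descList-tabulate (g ∘ Fin.suc) (f ∘ Fin.suc) (step ∘ Fin.suc)) ⟩
    descList (tabulate g)
  ∎
  where open ≡-Reasoning

prefixDescents : ∀ {m} → (Fin (suc m) → ℕ) → Fin (suc m) → ℕ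
prefixDescents g s = descList (take (suc (toℕ s)) (tabulate g))

prefixDescents-suc : ∀ {m} (g : Fin (suc m) → ℕ) i →
  prefixDescents g (Fin.suc i) ≡ prefixDescents g (inject₁ i) + ⟦ g (Fin.suc i) < g (inject₁ i) ⟧
prefixDescents-suc g Fin.zero = +-identityʳ _
prefixDescents-suc g (Fin.suc i) =
  trans (cong (⟦ g (Fin.suc Fin.zero) < g Fin.zero ⟧ +_) (prefixDescents-suc (g ∘ Fin.suc) i))
        (sym (+-assoc ⟦ g (Fin.suc Fin.zero) < g Fin.zero ⟧ (prefixDescents (g ∘ Fin.suc) (inject₁ i)) _))

prefixDescents-last : ∀ m (g : Fin (suc m) → ℕ) → prefixDescents g (fromℕ m) ≡ descList (tabulate g)
prefixDescents-last m g rewrite Fin.toℕ-fromℕ m =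
  cong descList (take-all (suc m) (tabulate g) (≤-reflexive (length-tabulate g)))

module _ {n : ℕ} where

  private
    lex : IsStrictPartialOrder (Pointwise _≡_ _≡_) (LexLess {n})
    lex = ×-isStrictPartialOrder ℕ.<-isStrictPartialOrder (Fin.<-isStrictPartialOrder {n})

  LexLess-trans : Transitive (LexLess {n})
  LexLess-trans = IsStrictPartialOrder.trans lex

  LexLess-asym : Asymmetric (LexLess {n})
  LexLess-asym = IsStrictPartialOrder.asym lex

  LexLess-irrefl : ∀ {x} → ¬ LexLess {n} x x
  LexLess-irrefl = IsStrictPartialOrder.irrefl lex (refl , refl)

key : ∀ {n} → Permutation′ n → (Fin n → ℕ) → Fin n → ℕ × Fin n
key π ρ s = ρ s , π ⟨$⟩ʳ s

inject₁<suc : ∀ {m} (i : Fin m) → inject₁ i Fin.< Fin.suc i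
inject₁<suc i = Fin.≤̄⇒inject₁< Fin.≤-refl

Sorts⇔adjacent : ∀ {m} (π : Permutation′ (suc m)) (ρ : Fin (suc m) → ℕ) →
  Sorts π ρ ⇔ AdjacentPairs LexLess (key π ρ)
Sorts⇔adjacent π ρ = mk⇔ (λ sorts i → Equivalence.to (sorts (inject₁ i) (Fin.suc i)) (inject₁<suc i)) adjacent⇒sorts
  where
  adjacent⇒sorts : AdjacentPairs LexLess (key π ρ) → Sorts π ρ
  adjacent⇒sorts adjacent s t = mk⇔ increasing reflects
    where
    increasing : ∀ {s t} → s Fin.< t → LexLess (key π ρ s) (key π ρ t)
    increasing = adjacent⇒increasing {R = LexLess} LexLess-trans {f = key π ρ} adjacent
    reflects : LexLess (key π ρ s) (key π ρ t) → s Fin.< t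
    reflects s≺t with Fin.<-cmp s t
    ... | tri< s<t _ _ = s<t
    ... | tri≈ _ refl _ = ⊥-elim (LexLess-irrefl s≺t)
    ... | tri> _ _ t<s = ⊥-elim (LexLess-asym s≺t (increasing t<s))

numPiles-sorting : ∀ {m} (π : Permutation′ (suc m)) (ρ : Fin (suc m) → ℕ) → Sorts π ρ →
  numPiles ρ ≡ 1 + ascents (tabulate ρ)
numPiles-sorting π ρ sorts = trans (cong (length ∘ deduplicate _≟_) (map-tabulate id ρ))
  (length-deduplicate-≤-linked (Linked-tabulate⁺ {f = ρ} monotone))
  where
  monotone : AdjacentPairs _≤_ ρ
  monotone i with Equivalence.to (Sorts⇔adjacent π ρ) sorts i
  ... | inj₁ ρᵢ<ρᵢ₊₁      = <⇒≤ ρᵢ<ρᵢ₊₁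
  ... | inj₂ (ρᵢ≡ρᵢ₊₁ , _) = ≤-reflexive ρᵢ≡ρᵢ₊₁

position : ∀ {n} → Permutation′ n → Fin n → ℕ
position π s = toℕ (π ⟨$⟩ʳ s)

position-injective : ∀ {n} (π : Permutation′ n) {s t} → position π s ≡ position π t → s ≡ t
position-injective π eq = trans (sym (inverseˡ π)) (trans (cong (π ⟨$⟩ˡ_) (Fin.toℕ-injective eq)) (inverseˡ π))

desc≡descList-tabulate : ∀ {n} (π : Permutation′ n) → desc π ≡ descList (tabulate (position π))
desc≡descList-tabulate π = cong descList (map-tabulate id (position π))

desc≤ascents-sorting : ∀ {m} (π : Permutation′ (suc m)) (ρ : Fin (suc m) → ℕ) → Sorts π ρ →
  desc π ≤ ascents (tabulate ρ)
desc≤ascents-sorting π ρ sorts = subst₂ _≤_ (sym (desc≡descList-tabulate π)) refl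
  (descList-tabulate≤ascents-tabulate (position π) ρ descent⇒ascent)
  where
  descent⇒ascent : ∀ i → position π (Fin.suc i) < position π (inject₁ i) → ρ (inject₁ i) < ρ (Fin.suc i)
  descent⇒ascent i descent with Equivalence.to (Sorts⇔adjacent π ρ) sorts i
  ... | inj₁ ascent       = ascent
  ... | inj₂ (_ , ascent) = ⊥-elim (<-asym descent ascent)

module _ {m : ℕ} (π : Permutation′ (suc m)) where

  ρ*≡1+prefixDescents : ∀ s → ρ* π s ≡ 1 + prefixDescents (position π) s
  ρ*≡1+prefixDescents s = cong (λ xs → 1 + descList (take (suc (toℕ s)) xs)) (map-tabulate id (position π))

  ρ*-suc : ∀ i → ρ* π (Fin.suc i) ≡ ρ* π (inject₁ i) + ⟦ position π (Fin.suc i) < position π (inject₁ i) ⟧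
  ρ*-suc i = begin
      ρ* π (Fin.suc i)
    ≡⟨ ρ*≡1+prefixDescents (Fin.suc i) ⟩
      1 + prefixDescents (position π) (Fin.suc i)
    ≡⟨ cong suc (prefixDescents-suc (position π) i) ⟩
      1 + prefixDescents (position π) (inject₁ i) + ⟦ position π (Fin.suc i) < position π (inject₁ i) ⟧
    ≡⟨ cong (_+ ⟦ position π (Fin.suc i) < position π (inject₁ i) ⟧) (sym (ρ*≡1+prefixDescents (inject₁ i))) ⟩
      ρ* π (inject₁ i) + ⟦ position π (Fin.suc i) < position π (inject₁ i) ⟧
    ∎
    where open ≡-Reasoning

  ρ*-sorts : Sorts π (ρ* π)
  ρ*-sorts = Equivalence.from (Sorts⇔adjacent π (ρ* π)) adjacent
    where
    adjacent : AdjacentPairs LexLess (key π (ρ* π))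
    adjacent i with position π (Fin.suc i) ℕ.<? position π (inject₁ i)
    ... | yes descent = inj₁ (begin-strict
        ρ* π (inject₁ i)
      <⟨ m<m+n _ (s≤s z≤n) ⟩
        ρ* π (inject₁ i) + 1
      ≡⟨ cong (ρ* π (inject₁ i) +_) (sym (⟦<⟧-true descent)) ⟩
        ρ* π (inject₁ i) + ⟦ position π (Fin.suc i) < position π (inject₁ i) ⟧
      ≡⟨ sym (ρ*-suc i) ⟩
        ρ* π (Fin.suc i)
      ∎)
      where open ℕ.≤-Reasoning
    ... | no ¬descent = inj₂ (same-pile , ≤∧≢⇒< (≮⇒≥ ¬descent) distinct)
      where
      same-pile : ρ* π (inject₁ i) ≡ ρ* π (Fin.suc i)
      same-pile = sym (trans (ρ*-suc i) (trans (cong (ρ* π (inject₁ i) +_) (⟦<⟧-false ¬descent)) (+-identityʳ _)))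
      distinct : position π (inject₁ i) ≢ position π (Fin.suc i)
      distinct = Fin.<⇒≢ (inject₁<suc i) ∘ position-injective π

  ρ*-last : ρ* π (fromℕ m) ≡ 1 + desc π
  ρ*-last = trans (ρ*≡1+prefixDescents (fromℕ m))
    (cong suc (trans (prefixDescents-last m (position π)) (sym (desc≡descList-tabulate π))))

  numPiles-ρ* : numPiles (ρ* π) ≡ 1 + desc π
  numPiles-ρ* = trans (numPiles-sorting π (ρ* π) ρ*-sorts)
    (cong suc (trans (ascents-tabulate≡descList-tabulate (position π) (ρ* π) ρ*-suc) (sym (desc≡descList-tabulate π))))

lemma3 : (m : ℕ) → (π : Permutation′ (suc m)) →
    Sorts π (ρ* π)
    × numPiles (ρ* π) ≡ ρ* π (fromℕ m)
    × ρ* π (fromℕ m) ≡ 1 + desc π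
    × ((ρ : Fin (suc m) → ℕ) → Sorts π ρ → numPiles (ρ* π) ≤ numPiles ρ)
lemma3 m π = ρ*-sorts π , trans (numPiles-ρ* π) (sym (ρ*-last π)) , ρ*-last π , minimal
  where
  minimal : (ρ : Fin (suc m) → ℕ) → Sorts π ρ → numPiles (ρ* π) ≤ numPiles ρ
  minimal ρ sorts = begin
      numPiles (ρ* π)
    ≡⟨ numPiles-ρ* π ⟩
      1 + desc π
    ≤⟨ s≤s (desc≤ascents-sorting π ρ sorts) ⟩
      1 + ascents (tabulate ρ)
    ≡⟨ sym (numPiles-sorting π ρ sorts) ⟩
      numPiles ρ
    ∎
    where open ℕ.≤-Reasoning
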